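{- Let $n\ge 2$ and $t\ge 1$ be integers and let $O=(v^1,\dots,v^{n^t})$ be a list of $n^t$ elements of $V(K_n^t)$. Then $O$ is an ordering of $V(K_n^t)$ that induces a consecutive radio labeling if and only if for all $1<i\le n^t$ and all integers $1\le k<t$ with $i-k\ge1$, the vertices $v^i$ and $v^{i-k}$ share at most $k-1$ coordinates, and $O$ contains no repetition, i.e. $v^i\ne v^j$ for $i\ne j$.
   Context: $K_n$ is the complete graph on $\{v_1,\dots,v_n\}$ and $K_n^t$ is the Cartesian product of $t$ copies of $K_n$; its vertices are $t$-tuples with entries in $\{v_1,\dots,v_n\}$, two vertices are adjacent iff they differ in exactly one coordinate, the distance between two vertices is the number of coordinates in which they differ, and the diameter is $t$. Two vertices share coordinate $j$ if their $j$-th entries are equal. A radio labeling of a connected graph $H$ is $f:V(H)\to\mathbb{Z}^+$ with $|f(u)-f(v)|\ge\mathrm{diam}(H)+1-d(u,v)$ for distinct $u,v$; it is consecutive if it is a bijection onto $\{1,\dots,|V(H)|\}$. An ordering of $V(H)$ is a list of all vertices without repetition. The radio labeling induced by an ordering $(v^1,\dots,v^{|V|})$ is $f(v^1)=1$, $f(v^i)=\min\{x\in\mathbb{Z}:x>f(v^{i-1}),\ |x-f(v^j)|\ge\mathrm{diam}(H)+1-d(v^i,v^j)\ \forall\, 1\le j<i\}$. -}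

module Defs where

open import Data.Nat using (ℕ; zero; suc; _+_; _∸_; _≤_; _<_; ∣_-_∣)
open import Data.Fin using (Fin; toℕ)
open import Data.Vec using (Vec; []; _∷_; lookup)
open import Data.Product using (_×_; ∃; Σ)
open import Relation.Binary.PropositionalEquality using (_≡_; _≢_)
open import Relation.Nullary using (¬_; yes; no)
open import Data.Fin using (_≟_)

-- Vertices of K_n^t: t-tuples over the n vertices v_1..v_n of K_n (encoded as Fin n).
Vertex : ℕ → ℕ → Set
Vertex n t = Vec (Fin n) t

-- Distance in K_n^t: number of coordinates in which two vertices differ.
dist : ∀ {n t} → Vertex n t → Vertex n t → ℕ
dist [] [] = 0
dist (a ∷ u) (b ∷ v) with a ≟ b
... | yes _ = dist u v
... | no  _ = suc (dist u v)

shared : ∀ {n t} → Vertex n t → Vertex n t → ℕ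
shared [] [] = 0
shared (a ∷ u) (b ∷ v) with a ≟ b
... | yes _ = suc (shared u v)
... | no  _ = shared u v

-- A list O = (v^1,...,v^N) of N = n^t vertices, positions indexed 0-based by Fin N.
-- O is an ordering of V(K_n^t): all vertices, no repetition.
IsOrdering : ∀ {n t N} → Vec (Vertex n t) N → Set
IsOrdering {n} {t} {N} O =
  (∀ (i j : Fin N) → lookup O i ≡ lookup O j → i ≡ j) ×
  (∀ (v : Vertex n t) → ∃ λ (i : Fin N) → lookup O i ≡ v)

-- Labels at positions: L i is the label f(v^i) of the i-th vertex of O.
-- Admissible O L i x : x satisfies the radio constraint (diam = t) against all
-- earlier vertices v^j (j < i) of the ordering.
Admissible : ∀ {n t N} → Vec (Vertex n t) N → (Fin N → ℕ) → Fin N → ℕ → Set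
Admissible {n} {t} {N} O L i x =
  ∀ (j : Fin N) → toℕ j < toℕ i →
    suc t ∸ dist (lookup O i) (lookup O j) ≤ ∣ x - L j ∣

Induced : ∀ {n t N} → Vec (Vertex n t) N → (Fin N → ℕ) → Set
Induced {n} {t} {N} O L =
  (∀ (i : Fin N) → toℕ i ≡ 0 → L i ≡ 1) ×
  (∀ (i j : Fin N) → toℕ i ≡ suc (toℕ j) →
     (L j < L i) × Admissible O L i (L i) ×
     (∀ (x : ℕ) → L j < x → x < L i → ¬ Admissible O L i x))

IsRadio : ∀ {n t N} → Vec (Vertex n t) N → (Fin N → ℕ) → Set
IsRadio {n} {t} {N} O L =
  (∀ (i : Fin N) → 1 ≤ L i) ×
  (∀ (i j : Fin N) → i ≢ j →
     suc t ∸ dist (lookup O i) (lookup O j) ≤ ∣ L i - L j ∣)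

IsConsecutive : ∀ {N} → (Fin N → ℕ) → Set
IsConsecutive {N} L =
  (∀ (i : Fin N) → 1 ≤ L i × L i ≤ N) ×
  (∀ (i j : Fin N) → L i ≡ L j → i ≡ j) ×
  (∀ (m : ℕ) → 1 ≤ m → m ≤ N → ∃ λ (i : Fin N) → L i ≡ m)

InducesConsecutive : ∀ {n t N} → Vec (Vertex n t) N → Set
InducesConsecutive {n} {t} {N} O =
  ∃ λ (L : Fin N → ℕ) → Induced O L × IsRadio O L × IsConsecutive L

-- Since d(u,v) + (number of shared coordinates) = t, the radio condition between
-- v^i and v^j reads shared(v^i, v^j) + 1 ≤ |f(v^i) − f(v^j)|. An induced labeling
-- strictly increases along O, starts at 1 and, being consecutive, never exceeds n^t,
-- so it must be f(v^i) = i; the condition then says that v^i and v^(i−k) share at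
-- most k − 1 coordinates, which is automatic for k ≥ t as distinct vertices share
-- fewer than t coordinates. Conversely, under these conditions f(v^i) = i satisfies
-- every radio constraint, hence is the induced labeling (the next integer is always
-- the least admissible label), and n^t distinct vertices exhaust V(K_n^t) by
-- counting.
module Submission where

open import Defs
open import Data.Nat using (ℕ; zero; suc; _^_; _∸_; _+_; _≤_; _<_; z≤n; s≤s; ∣_-_∣)
open import Data.Nat.Properties
open import Data.Fin as Fin using (Fin; toℕ; fromℕ; fromℕ<; combine; punchOut)
open import Data.Fin.Properties
  using (toℕ<n; toℕ-fromℕ; toℕ-fromℕ<; toℕ-injective; combine-injective; punchOut-injective; any?; injective⇒≤)
open import Data.Vec using (Vec; []; _∷_; lookup)
open import Data.Product using (_×_; _,_; ∃; proj₁; proj₂)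
open import Function using (_∘_)
open import Function.Bundles using (_⇔_; mk⇔; Equivalence)
open import Function.Definitions using (Injective)
open import Relation.Binary.PropositionalEquality
  using (_≡_; _≢_; refl; sym; trans; cong; cong₂; subst; subst₂; module ≡-Reasoning)
open import Relation.Binary.Definitions using (tri<; tri≈; tri>)
open import Relation.Nullary using (¬_; yes; no; contradiction)

dist+shared≡t : ∀ {n t} (u v : Vertex n t) → dist u v + shared u v ≡ t
dist+shared≡t [] [] = refl
dist+shared≡t (a ∷ u) (b ∷ v) with a Fin.≟ b
... | yes _ = trans (+-suc (dist u v) (shared u v)) (cong suc (dist+shared≡t u v))
... | no  _ = cong suc (dist+shared≡t u v)

dist-sym : ∀ {n t} (u v : Vertex n t) → dist u v ≡ dist v u
dist-sym [] [] = refl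
dist-sym (a ∷ u) (b ∷ v) with a Fin.≟ b | b Fin.≟ a
... | yes _   | yes _   = dist-sym u v
... | yes a≡b | no  b≢a = contradiction (sym a≡b) b≢a
... | no  a≢b | yes b≡a = contradiction (sym b≡a) a≢b
... | no  _   | no  _   = cong suc (dist-sym u v)

shared≤t : ∀ {n t} (u v : Vertex n t) → shared u v ≤ t
shared≤t u v = subst (shared u v ≤_) (dist+shared≡t u v) (m≤n+m (shared u v) (dist u v))

shared<t : ∀ {n t} (u v : Vertex n t) → u ≢ v → shared u v < t
shared<t [] [] u≢v = contradiction refl u≢v
shared<t (a ∷ u) (b ∷ v) a∷u≢b∷v with a Fin.≟ b
... | yes refl = s≤s (shared<t u v (a∷u≢b∷v ∘ cong (a ∷_)))
... | no  _    = s≤s (shared≤t u v)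

suc[t]∸dist≡suc[shared] : ∀ {n t} (u v : Vertex n t) → suc t ∸ dist u v ≡ suc (shared u v)
suc[t]∸dist≡suc[shared] {t = t} u v = begin
  suc t ∸ d            ≡⟨ cong (λ m → suc m ∸ d) (sym (dist+shared≡t u v)) ⟩
  suc (d + s) ∸ d      ≡⟨ cong (_∸ d) (sym (+-suc d s)) ⟩
  d + suc s ∸ d        ≡⟨ m+n∸m≡n d (suc s) ⟩
  suc s                ∎
  where
  open ≡-Reasoning
  d s : ℕ
  d = dist u v
  s = shared u v

encode : ∀ {n t} → Vertex n t → Fin (n ^ t)
encode []      = Fin.zero
encode (a ∷ v) = combine a (encode v)

encode-injective : ∀ {n t} (u v : Vertex n t) → encode u ≡ encode v → u ≡ v
encode-injective [] [] _ = refl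
encode-injective (a ∷ u) (b ∷ v) e with combine-injective a (encode u) b (encode v) e
... | refl , eu≡ev with encode-injective u v eu≡ev
... | refl = refl

injective⇒surjective : ∀ {N} (f : Fin N → Fin N) → Injective _≡_ _≡_ f → ∀ y → ∃ λ i → f i ≡ y
injective⇒surjective {suc M} f f-injective y with any? (λ i → f i Fin.≟ y)
... | yes hit = hit
... | no  miss = contradiction (injective⇒≤ g-injective) 1+n≰n
  where
  y≢f : ∀ i → y ≢ f i
  y≢f i y≡fi = miss (i , sym y≡fi)
  g : Fin (suc M) → Fin M
  g i = punchOut (y≢f i)
  g-injective : Injective _≡_ _≡_ g
  g-injective {i} {j} = f-injective ∘ punchOut-injective (y≢f i) (y≢f j)

injective⇒ordering : ∀ {n t} (O : Vec (Vertex n t) (n ^ t)) →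
  (∀ i j → lookup O i ≡ lookup O j → i ≡ j) → IsOrdering O
injective⇒ordering O O-injective = O-injective , covers
  where
  covers : ∀ v → ∃ λ i → lookup O i ≡ v
  covers v with injective⇒surjective (encode ∘ lookup O)
                  (O-injective _ _ ∘ encode-injective _ _) (encode v)
  ... | i , e = i , encode-injective _ _ e

<⇒≡suc+ : ∀ {m n} → m < n → ∃ λ k → n ≡ suc k + m
<⇒≡suc+ {m} {n} m<n = n ∸ suc m , sym (trans (sym (+-suc (n ∸ suc m) m)) (m∸n+n≡m m<n))

∣k+n-n∣≡k : ∀ k n → ∣ k + n - n ∣ ≡ k
∣k+n-n∣≡k k n = trans (∣-∣-comm (k + n) n) (trans (cong (∣ n -_∣) (+-comm k n)) (∣m-m+n∣≡n n k))

gap⇒≢ : ∀ {N} {i j : Fin N} {k} → toℕ i ≡ suc k + toℕ j → i ≢ j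
gap⇒≢ {j = j} i≡1+k+j refl = m≢1+n+m (toℕ j) i≡1+k+j

Increasing : ∀ {N} → (Fin N → ℕ) → Set
Increasing {N} L = ∀ (i j : Fin N) → toℕ i ≡ suc (toℕ j) → L j < L i

increasing⇒+-gap-≤ : ∀ {N} (L : Fin N → ℕ) → Increasing L →
  ∀ k (i j : Fin N) → toℕ i ≡ k + toℕ j → L j + k ≤ L i
increasing⇒+-gap-≤ L increasing zero i j i≡j rewrite toℕ-injective {i = i} {j = j} i≡j =
  ≤-reflexive (+-identityʳ (L j))
increasing⇒+-gap-≤ {N} L increasing (suc k) i j i≡1+k+j = begin
  L j + suc k   ≡⟨ +-suc (L j) k ⟩
  suc (L j + k) ≤⟨ s≤s (increasing⇒+-gap-≤ L increasing k i′ j (toℕ-fromℕ< k+j<N)) ⟩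
  suc (L i′)    ≤⟨ increasing i i′ (trans i≡1+k+j (cong suc (sym (toℕ-fromℕ< k+j<N)))) ⟩
  L i           ∎
  where
  open ≤-Reasoning
  k+j<N : k + toℕ j < N
  k+j<N = <-trans (n<1+n _) (subst (_< N) i≡1+k+j (toℕ<n i))
  i′ : Fin N
  i′ = fromℕ< k+j<N

increasing-in-[1,N]⇒≡suc∘toℕ : ∀ {N} (L : Fin N → ℕ) → Increasing L →
  (∀ i → toℕ i ≡ 0 → L i ≡ 1) → (∀ i → L i ≤ N) → ∀ i → L i ≡ suc (toℕ i)
increasing-in-[1,N]⇒≡suc∘toℕ {suc M} L increasing L₀≡1 L≤N i = ≤-antisym upper lower
  where
  open ≤-Reasoning
  gap : ∀ k (i j : Fin (suc M)) → toℕ i ≡ k + toℕ j → L j + k ≤ L i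
  gap = increasing⇒+-gap-≤ L increasing
  d : ℕ
  d = M ∸ toℕ i
  i≤M : toℕ i ≤ M
  i≤M = ≤-pred (toℕ<n i)
  lower : suc (toℕ i) ≤ L i
  lower = subst (λ l → l + toℕ i ≤ L i) (L₀≡1 Fin.zero refl)
    (gap (toℕ i) i Fin.zero (sym (+-identityʳ (toℕ i))))
  upper : L i ≤ suc (toℕ i)
  upper = +-cancelʳ-≤ d (L i) (suc (toℕ i)) (begin
    L i + d         ≤⟨ gap d (fromℕ M) i (trans (toℕ-fromℕ M) (sym (m∸n+n≡m i≤M))) ⟩
    L (fromℕ M)     ≤⟨ L≤N (fromℕ M) ⟩
    suc M           ≡⟨ cong suc (sym (m+[n∸m]≡n i≤M)) ⟩
    suc (toℕ i + d) ∎)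

position : ∀ {N} → Fin N → ℕ
position i = suc (toℕ i)

position-consecutive : ∀ {N} → IsConsecutive (position {N})
position-consecutive {N} = (λ i → s≤s z≤n , toℕ<n i) , (λ i j → toℕ-injective ∘ suc-injective) , hit
  where
  hit : ∀ m → 1 ≤ m → m ≤ N → ∃ λ i → position i ≡ m
  hit (suc m) _ m<N = fromℕ< m<N , cong suc (toℕ-fromℕ< m<N)

module _ {n t N} (O : Vec (Vertex n t) N) where

  Spaced : Set
  Spaced = ∀ (i j : Fin N) (k : ℕ) → toℕ i ≡ suc k + toℕ j → shared (lookup O i) (lookup O j) ≤ k

  position-radio⇔shared≤gap : ∀ (i j : Fin N) (k : ℕ) → toℕ i ≡ suc k + toℕ j →
    (suc t ∸ dist (lookup O i) (lookup O j) ≤ ∣ position i - position j ∣) ⇔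
    (shared (lookup O i) (lookup O j) ≤ k)
  position-radio⇔shared≤gap i j k i≡1+k+j =
    mk⇔ (≤-pred ∘ subst₂ _≤_ demand supply) (subst₂ _≤_ (sym demand) (sym supply) ∘ s≤s)
    where
    demand : suc t ∸ dist (lookup O i) (lookup O j) ≡ suc (shared (lookup O i) (lookup O j))
    demand = suc[t]∸dist≡suc[shared] (lookup O i) (lookup O j)
    supply : ∣ position i - position j ∣ ≡ suc k
    supply = trans (cong (∣_- toℕ j ∣) i≡1+k+j) (∣k+n-n∣≡k (suc k) (toℕ j))

  spaced⇒admissible : Spaced → ∀ i → Admissible O position i (position i)
  spaced⇒admissible spaced i j j<i with <⇒≡suc+ j<i
  ... | k , i≡1+k+j = Equivalence.from (position-radio⇔shared≤gap i j k i≡1+k+j) (spaced i j k i≡1+k+j)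

  spaced⇒induced : Spaced → Induced O position
  spaced⇒induced spaced = (λ _ → cong suc) , step
    where
    step : ∀ i j → toℕ i ≡ suc (toℕ j) →
      position j < position i × Admissible O position i (position i) ×
      (∀ x → position j < x → x < position i → ¬ Admissible O position i x)
    step i j i≡1+j = ≤-reflexive (cong suc (sym i≡1+j)) , spaced⇒admissible spaced i , between
      where
      between : ∀ x → position j < x → x < position i → ¬ Admissible O position i x
      between x j+1<x x<i+1 _ = 1+n≰n (subst (suc (suc (toℕ j)) ≤_) i≡1+j (≤-trans j+1<x (≤-pred x<i+1)))

  spaced⇒radio : Spaced → IsRadio O position
  spaced⇒radio spaced = (λ _ → s≤s z≤n) , radio
    where
    radio : ∀ i j → i ≢ j → suc t ∸ dist (lookup O i) (lookup O j) ≤ ∣ position i - position j ∣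
    radio i j i≢j with <-cmp (toℕ i) (toℕ j)
    ... | tri< i<j _ _ = subst₂ _≤_ (cong (suc t ∸_) (dist-sym (lookup O j) (lookup O i)))
                           (∣-∣-comm (position j) (position i)) (spaced⇒admissible spaced j i i<j)
    ... | tri≈ _ i≡j _ = contradiction (toℕ-injective i≡j) i≢j
    ... | tri> _ _ j<i = spaced⇒admissible spaced i j j<i

  FewSharedAtShortGaps : Set
  FewSharedAtShortGaps = ∀ (i j : Fin N) (k : ℕ) → 1 ≤ k → k < t → toℕ i ≡ k + toℕ j →
    shared (lookup O i) (lookup O j) ≤ k ∸ 1

  Distinct : Set
  Distinct = ∀ (i j : Fin N) → i ≢ j → lookup O i ≢ lookup O j

  fewSharedAtShortGaps∧distinct⇒spaced : FewSharedAtShortGaps → Distinct → Spaced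
  fewSharedAtShortGaps∧distinct⇒spaced few distinct i j k i≡1+k+j with suc k <? t
  ... | yes 1+k<t = few i j (suc k) (s≤s z≤n) 1+k<t i≡1+k+j
  ... | no  1+k≮t = ≤-pred (≤-trans (shared<t _ _ (distinct i j (gap⇒≢ i≡1+k+j))) (≮⇒≥ 1+k≮t))

  inducesConsecutive⇒fewSharedAtShortGaps : InducesConsecutive O → FewSharedAtShortGaps
  inducesConsecutive⇒fewSharedAtShortGaps (L , (L₀≡1 , steps) , (_ , radio) , (bounds , _))
                                          i j (suc k) _ _ i≡1+k+j =
    Equivalence.to (position-radio⇔shared≤gap i j k i≡1+k+j)
      (subst (_ ≤_) (cong₂ ∣_-_∣ (L≡position i) (L≡position j)) (radio i j (gap⇒≢ i≡1+k+j)))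
    where
    L≡position : ∀ i → L i ≡ position i
    L≡position = increasing-in-[1,N]⇒≡suc∘toℕ L (λ i j → proj₁ ∘ steps i j) L₀≡1 (proj₂ ∘ bounds)

  distinct⇒injective : Distinct → ∀ i j → lookup O i ≡ lookup O j → i ≡ j
  distinct⇒injective distinct i j Oi≡Oj with i Fin.≟ j
  ... | yes i≡j = i≡j
  ... | no  i≢j = contradiction Oi≡Oj (distinct i j i≢j)

corollary8 : (n t : ℕ) → 2 ≤ n → 1 ≤ t → (O : Vec (Vertex n t) (n ^ t)) →
    (IsOrdering O × InducesConsecutive O) ⇔
    ((∀ (i j : Fin (n ^ t)) (k : ℕ) → 1 ≤ k → k < t → toℕ i ≡ k + toℕ j →
        shared (lookup O i) (lookup O j) ≤ k ∸ 1) ×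
     (∀ (i j : Fin (n ^ t)) → i ≢ j → lookup O i ≢ lookup O j))
corollary8 n t _ _ O = mk⇔ necessary sufficient
  where
  necessary : IsOrdering O × InducesConsecutive O → FewSharedAtShortGaps O × Distinct O
  necessary ((O-injective , _) , induces) =
    inducesConsecutive⇒fewSharedAtShortGaps O induces , λ i j i≢j → i≢j ∘ O-injective i j

  sufficient : FewSharedAtShortGaps O × Distinct O → IsOrdering O × InducesConsecutive O
  sufficient (few , distinct) =
    injective⇒ordering O (distinct⇒injective O distinct) ,
    position , spaced⇒induced O spaced , spaced⇒radio O spaced , position-consecutive
    where
    spaced : Spaced O
    spaced = fewSharedAtShortGaps∧distinct⇒spaced O few distinct
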